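{- Let $p\geq 7$ be a prime and $r\geq 4$ be even. Then $C_{S(p^r)^*}\leq 5$.
   Context: For a natural number $m$, $\mathbb Z_m=\mathbb Z/m\mathbb Z$ and $S(m)^*=\{x^2:x\in\mathbb Z_m\}\setminus\{0\}$. For $A\subseteq\mathbb Z_m$, a subsequence $T$ of a sequence $(x_1,\dots,x_k)$ in $\mathbb Z_m$, with nonempty index set $I$, is an $A$-weighted zero-sum subsequence if there exist $a_i\in A$ ($i\in I$) with $\sum_{i\in I}a_ix_i=0$. $C_{S(m)^*}$ is the least positive integer $k$ such that every sequence of length $k$ in $\mathbb Z_m$ has an $S(m)^*$-weighted zero-sum subsequence consisting of consecutive terms. -}

module Defs where

open import Data.Nat using (ℕ; _+_; _*_)
open import Data.Nat.Divisibility using (_∣_)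
open import Data.Fin using (Fin; toℕ)
open import Data.List using (List; []; _∷_; _++_; length; zipWith)
open import Data.Nat.ListAction using (sum)
open import Data.List.Relation.Unary.All using (All)
open import Data.Product using (Σ; ∃; ∃-syntax; _×_)
open import Relation.Binary.PropositionalEquality using (_≡_; _≢_)
open import Relation.Nullary using (¬_)

-- Elements of ℤ_m are represented by Fin m (residues 0,…,m-1).

NonzeroSquare : (m : ℕ) → Fin m → Set
NonzeroSquare m a =
  (toℕ a ≢ 0) × (∃[ x ] ∃[ q ] (toℕ {m} x * toℕ x ≡ q * m + toℕ a))

weightedSum : {m : ℕ} → List (Fin m) → List (Fin m) → ℕ
weightedSum ws xs = sum (zipWith (λ w x → toℕ w * toℕ x) ws xs)

WeightedZeroSum : (m : ℕ) → List (Fin m) → Set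
WeightedZeroSum m ys =
  ∃[ ws ] (All (NonzeroSquare m) ws × length ws ≡ length ys × m ∣ weightedSum ws ys)

HasConsecWZS : (m : ℕ) → List (Fin m) → Set
HasConsecWZS m xs =
  ∃[ pre ] ∃[ mid ] ∃[ suf ]
    (xs ≡ pre ++ mid ++ suf × mid ≢ [] × WeightedZeroSum m mid)

-- k has the defining property of C_{S(m)^*}: every length-k sequence in ℤ_m
-- has an S(m)^*-weighted zero-sum consecutive subsequence.
CProperty : (m k : ℕ) → Set
CProperty m k = (xs : List (Fin m)) → length xs ≡ k → HasConsecWZS m xs

-- Write m = p^(2R), R ≥ 2. A term divisible by p² is annihilated on its own by the weight
-- (p^(R-1))². Otherwise every term has p-adic valuation 0 or 1, so three of the five terms share
-- a valuation, and after scaling the weights by a power of p it suffices to find units uᵢ with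
-- Σ cᵢ uᵢ² ≡ 0 modulo p² or p³, for a list c containing three units a, b, c. Modulo p ≥ 7 the
-- form a x² + b y² + c z² + T has a zero at units: a x² and -(b y² + T) take p + 1 values in
-- p residue classes, and a zero on an axis is moved off it along a line of well-chosen slope.
-- Hensel's lemma in x then lifts the zero to any power of p.
module Submission where

open import Defs

open import Data.Nat using (ℕ; zero; suc; pred; _+_; _*_; _^_; _∸_; _%_; _≤_; _<_; z≤n; s≤s; s≤s⁻¹; z<s;
                           NonZero; >-nonZero; nonTrivial⇒n>1)
open import Data.Nat.Properties
open import Data.Nat.DivMod
open import Data.Nat.Divisibility
open import Data.Nat.Primality using (Prime; euclidsLemma; prime⇒nonZero; prime⇒nonTrivial; prime⇒irreducible)
open import Data.Nat.Coprimality using (Coprime; coprime-Bézout)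
open import Data.Nat.GCD using (module Bézout)
open import Data.Nat.ListAction using (sum)
open import Data.Nat.Tactic.RingSolver using (solve-∀)
import Data.Fin as Fin
open import Data.Fin using (Fin; toℕ; splitAt; join)
open import Data.Fin.Properties using (pigeonhole; ¬∀⟶∃¬; toℕ-injective; toℕ-fromℕ<; toℕ<n; join-splitAt)
open import Data.List using (List; []; _∷_; _++_; length; map)
open import Data.List.Properties using (++-identityʳ; length-++; length-map)
open import Data.List.Relation.Unary.All using (All; []; _∷_)
import Data.List.Relation.Unary.All as All
import Data.List.Relation.Unary.All.Properties as All
open import Data.List.Relation.Unary.All.Properties using (¬Any⇒All¬)
open import Data.List.Relation.Unary.Any using (any?)
open import Data.List.Membership.Propositional using (find)
open import Data.List.Membership.Propositional.Properties using (∈-∃++)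
open import Data.Sum using (_⊎_; inj₁; inj₂; [_,_]′)
open import Data.Product using (∃; ∃₂; ∃-syntax; _×_; _,_; proj₁; proj₂)
open import Data.Empty using (⊥-elim)
open import Function using (_∘_)
open import Relation.Nullary using (¬_; Dec; yes; no; contradiction)
open import Relation.Nullary.Decidable using (_⊎-dec_)
open import Relation.Binary.Bundles using (Setoid)
open import Relation.Binary.Structures using (IsEquivalence)
open import Relation.Binary.Definitions using (Decidable)
open import Relation.Binary.PropositionalEquality
import Relation.Binary.Reasoning.Setoid as SetoidReasoning

module Congruence (n : ℕ) .{{_ : NonZero n}} where

  infix 4 _≈_ _≈?_
  record _≈_ (x y : ℕ) : Set where
    constructor mod-≡
    field rem-≡ : x % n ≡ y % n
  open _≈_ public

  ≈-isEquivalence : IsEquivalence _≈_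
  ≈-isEquivalence = record
    { refl  = mod-≡ refl
    ; sym   = λ (mod-≡ e) → mod-≡ (sym e)
    ; trans = λ (mod-≡ e) (mod-≡ f) → mod-≡ (trans e f)
    }

  ≈-setoid : Setoid _ _
  ≈-setoid = record { isEquivalence = ≈-isEquivalence }

  open IsEquivalence ≈-isEquivalence public
    using () renaming (refl to ≈-refl; sym to ≈-sym; trans to ≈-trans; reflexive to ≡⇒≈)

  module ≈-Reasoning = SetoidReasoning ≈-setoid

  _≈?_ : Decidable _≈_
  x ≈? y with x % n ≟ y % n
  ... | yes e = yes (mod-≡ e)
  ... | no ne = no λ e → ne (rem-≡ e)

  +-cong : ∀ {a b c d} → a ≈ b → c ≈ d → a + c ≈ b + d
  +-cong {a} {b} {c} {d} (mod-≡ e) (mod-≡ f) = mod-≡ (begin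
    (a + c) % n               ≡⟨ %-distribˡ-+ a c n ⟩
    (a % n + c % n) % n       ≡⟨ cong₂ (λ u v → (u + v) % n) e f ⟩
    (b % n + d % n) % n       ≡⟨ %-distribˡ-+ b d n ⟨
    (b + d) % n               ∎)
    where open ≡-Reasoning

  *-cong : ∀ {a b c d} → a ≈ b → c ≈ d → a * c ≈ b * d
  *-cong {a} {b} {c} {d} (mod-≡ e) (mod-≡ f) = mod-≡ (begin
    (a * c) % n               ≡⟨ %-distribˡ-* a c n ⟩
    (a % n * (c % n)) % n     ≡⟨ cong₂ (λ u v → (u * v) % n) e f ⟩
    (b % n * (d % n)) % n     ≡⟨ %-distribˡ-* b d n ⟨
    (b * d) % n               ∎)
    where open ≡-Reasoning

  %-≈ : ∀ x → x % n ≈ x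
  %-≈ x = mod-≡ (m%n%n≡m%n x n)

  private
    0%n≡0 : 0 % n ≡ 0
    0%n≡0 = n∣m⇒m%n≡0 0 n (n ∣0)

  ∣⇒≈0 : ∀ {x} → n ∣ x → x ≈ 0
  ∣⇒≈0 {x} n∣x = mod-≡ (trans (n∣m⇒m%n≡0 x n n∣x) (sym 0%n≡0))

  ≈0⇒∣ : ∀ {x} → x ≈ 0 → n ∣ x
  ≈0⇒∣ {x} (mod-≡ e) = m%n≡0⇒n∣m x n (trans e 0%n≡0)

  +*n≈ : ∀ x k → x + k * n ≈ x
  +*n≈ x k = mod-≡ ([m+kn]%n≡m%n x k n)

  -- pred n * x plays the role of - x
  +-inverseʳ : ∀ x → x + pred n * x ≈ 0
  +-inverseʳ x = ≈-trans (≡⇒≈ (cong (_* x) (suc-pred n))) (∣⇒≈0 (m∣m*n x))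

  +-cancelʳ : ∀ {a b} c → a + c ≈ b + c → a ≈ b
  +-cancelʳ {a} {b} c e = begin
    a                         ≡⟨ +-identityʳ a ⟨
    a + 0                     ≈⟨ +-cong ≈-refl (+-inverseʳ c) ⟨
    a + (c + pred n * c)      ≡⟨ +-assoc a c _ ⟨
    (a + c) + pred n * c      ≈⟨ +-cong e ≈-refl ⟩
    (b + c) + pred n * c      ≡⟨ +-assoc b c _ ⟩
    b + (c + pred n * c)      ≈⟨ +-cong ≈-refl (+-inverseʳ c) ⟩
    b + 0                     ≡⟨ +-identityʳ b ⟩
    b                         ∎
    where open ≈-Reasoning

  +-cancelˡ : ∀ c {a b} → c + a ≈ c + b → a ≈ b
  +-cancelˡ c {a} {b} e = +-cancelʳ c (≈-trans (≡⇒≈ (+-comm a c)) (≈-trans e (≡⇒≈ (+-comm c b))))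

module ModPrime {p : ℕ} (p-prime : Prime p) where

  private instance
    p≢0 : NonZero p
    p≢0 = prime⇒nonZero p-prime

  open Congruence p public

  ∤-* : ∀ {a b} → p ∤ a → p ∤ b → p ∤ a * b
  ∤-* {a} {b} p∤a p∤b p∣ab = [ p∤a , p∤b ]′ (euclidsLemma a b p-prime p∣ab)

  ∤-resp-≈ : ∀ {a b} → a ≈ b → p ∤ a → p ∤ b
  ∤-resp-≈ a≈b p∤a p∣b = p∤a (≈0⇒∣ (≈-trans a≈b (∣⇒≈0 p∣b)))

  0<∧<p⇒∤ : ∀ {a} → 0 < a → a < p → p ∤ a
  0<∧<p⇒∤ 0<a a<p = >⇒∤ {{>-nonZero 0<a}} a<p

  ∤-pred : p ∤ pred p
  ∤-pred = 0<∧<p⇒∤ (suc[m]≤n⇒m≤pred[n] (nonTrivial⇒n>1 p {{prime⇒nonTrivial p-prime}}))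
                   (m≤pred[n]⇒suc[m]≤n ≤-refl)

  ∤⇒coprime : ∀ {a} → p ∤ a → Coprime a p
  ∤⇒coprime p∤a (d∣a , d∣p) with prime⇒irreducible p-prime d∣p
  ... | inj₁ d≡1 = d≡1
  ... | inj₂ refl = ⊥-elim (p∤a d∣a)

  inverse : ∀ {a} → p ∤ a → ∃ λ d → a * d ≈ 1
  inverse {a} p∤a with coprime-Bézout (∤⇒coprime p∤a)
  ... | Bézout.+- x y eq = x , (begin
    a * x          ≡⟨ *-comm a x ⟩
    x * a          ≡⟨ eq ⟨
    1 + y * p      ≈⟨ +*n≈ 1 y ⟩
    1              ∎)
    where open ≈-Reasoning
  ... | Bézout.-+ x y eq = x * pred p , +-cancelˡ (pred p) (begin
    pred p + a * (x * pred p)   ≡⟨ lemma a x (pred p) ⟩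
    (1 + x * a) * pred p        ≡⟨ cong (_* pred p) eq ⟩
    y * p * pred p              ≈⟨ ∣⇒≈0 (n∣m*n*o y (pred p)) ⟩
    0                           ≈⟨ +-inverseʳ 1 ⟨
    1 + pred p * 1              ≡⟨ +-comm 1 _ ⟩
    pred p * 1 + 1              ≡⟨ cong (_+ 1) (*-identityʳ (pred p)) ⟩
    pred p + 1                  ∎)
    where
    open ≈-Reasoning
    lemma : ∀ a x q → q + a * (x * q) ≡ (1 + x * a) * q
    lemma = solve-∀

  *-cancelʳ : ∀ {a b c} → p ∤ c → a * c ≈ b * c → a ≈ b
  *-cancelʳ {a} {b} {c} p∤c e with inverse p∤c
  ... | d , cd≈1 = begin
    a              ≡⟨ *-identityʳ a ⟨
    a * 1          ≈⟨ *-cong (≈-refl {a}) cd≈1 ⟨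
    a * (c * d)    ≡⟨ *-assoc a c d ⟨
    a * c * d      ≈⟨ *-cong e ≈-refl ⟩
    b * c * d      ≡⟨ *-assoc b c d ⟩
    b * (c * d)    ≈⟨ *-cong (≈-refl {b}) cd≈1 ⟩
    b * 1          ≡⟨ *-identityʳ b ⟩
    b              ∎
    where open ≈-Reasoning

  *-cancelˡ : ∀ {a b c} → p ∤ c → c * a ≈ c * b → a ≈ b
  *-cancelˡ {a} {b} {c} p∤c e =
    *-cancelʳ p∤c (≈-trans (≡⇒≈ (*-comm a c)) (≈-trans e (≡⇒≈ (*-comm c b))))

  linear-solvable : ∀ {a} → p ∤ a → ∀ M → ∃ λ t → M + a * t ≈ 0
  linear-solvable {a} p∤a M with inverse p∤a
  ... | d , ad≈1 = d * (pred p * M) , (begin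
    M + a * (d * (pred p * M))   ≡⟨ cong (M +_) (*-assoc a d _) ⟨
    M + a * d * (pred p * M)     ≈⟨ +-cong ≈-refl (*-cong ad≈1 ≈-refl) ⟩
    M + 1 * (pred p * M)         ≡⟨ cong (M +_) (*-identityˡ _) ⟩
    M + pred p * M               ≈⟨ +-inverseʳ M ⟩
    0                            ∎)
    where open ≈-Reasoning

  data Valuation≤1 (v : ℕ) : Set where
    val₀ : p ∤ v → Valuation≤1 v
    val₁ : ∀ {w} → v ≡ p * w → p ∤ w → Valuation≤1 v

  valuation≤1 : ∀ v → p * p ∤ v → Valuation≤1 v
  valuation≤1 v p²∤v with p ∣? v
  ... | no p∤v = val₀ p∤v
  ... | yes (divides w v≡w*p) =
    val₁ (trans v≡w*p (*-comm w p)) λ p∣w → p²∤v (subst (p * p ∣_) (sym v≡w*p) (*-monoˡ-∣ p p∣w))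

  ∤-square-multiple : ∀ X {D u} → .{{NonZero X}} → p ∣ D → p ∤ u → X * D ∤ X * (u * u)
  ∤-square-multiple X p∣D p∤u XD∣Xu² = ∤-* p∤u p∤u (∣-trans p∣D (*-cancelˡ-∣ X XD∣Xu²))

odd-prime : ∀ {p} → Prime p → 2 < p → ∃ λ h → p ≡ suc (h + h)
odd-prime {p} p-prime 2<p with p % 2 | m%n<n p 2 | m≡m%n+[m/n]*n p 2
... | 0 | _ | p≡[p/2]*2 with prime⇒irreducible p-prime (divides (p / 2) p≡[p/2]*2)
...   | inj₁ ()
...   | inj₂ 2≡p = ⊥-elim (<⇒≢ 2<p 2≡p)
odd-prime {p} p-prime 2<p | 1 | _ | p≡1+[p/2]*2 = p / 2 , trans p≡1+[p/2]*2 (lemma (p / 2))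
  where
  lemma : ∀ h → 1 + h * 2 ≡ suc (h + h)
  lemma = solve-∀
odd-prime _ _ | suc (suc _) | s≤s (s≤s ()) | _

module OddPrime {p : ℕ} (p-prime : Prime p) {h : ℕ} (p≡2h+1 : p ≡ suc (h + h)) where

  open ModPrime p-prime public

  private instance
    p≢0 : NonZero p
    p≢0 = prime⇒nonZero p-prime

  h<p : h < p
  h<p = subst (h <_) (sym p≡2h+1) (s≤s (m≤m+n h h))

  private
    square-gap : ∀ {a} i d → p ∤ a → i + d ≤ h → a * (i * i) ≈ a * ((i + d) * (i + d)) → d ≡ 0
    square-gap i zero p∤a _ _ = refl
    square-gap {a} i d@(suc _) p∤a i+d≤h e =
      ⊥-elim (∤-* p∤a (∤-* p∤d p∤2i+d) (≈0⇒∣ (≈-sym (+-cancelʳ (a * (i * i)) (begin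
        0 + a * (i * i)                    ≈⟨ e ⟩
        a * ((i + d) * (i + d))            ≡⟨ expand a i d ⟩
        a * (d * (i + (i + d))) + a * (i * i) ∎)))))
      where
      open ≈-Reasoning
      expand : ∀ a i d → a * ((i + d) * (i + d)) ≡ a * (d * (i + (i + d))) + a * (i * i)
      expand = solve-∀
      p∤d : p ∤ d
      p∤d = 0<∧<p⇒∤ z<s (≤-<-trans (≤-trans (m≤n+m d i) i+d≤h) h<p)
      p∤2i+d : p ∤ i + (i + d)
      p∤2i+d = 0<∧<p⇒∤ (<-≤-trans z<s (≤-trans (m≤n+m d i) (m≤n+m (i + d) i)))
        (subst (i + (i + d) <_) (sym p≡2h+1)
          (s≤s (+-mono-≤ (≤-trans (m≤m+n i d) i+d≤h) i+d≤h)))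

    squares-distinct-≤ : ∀ {a i j} → p ∤ a → i ≤ j → j ≤ h → a * (i * i) ≈ a * (j * j) → i ≡ j
    squares-distinct-≤ {a} {i} {j} p∤a i≤j j≤h e = begin
      i              ≡⟨ +-identityʳ i ⟨
      i + 0          ≡⟨ cong (i +_) gap≡0 ⟨
      i + (j ∸ i)    ≡⟨ m+[n∸m]≡n i≤j ⟩
      j              ∎
      where
      open ≡-Reasoning
      j≡i+gap : j ≡ i + (j ∸ i)
      j≡i+gap = sym (m+[n∸m]≡n i≤j)
      gap≡0 : j ∸ i ≡ 0
      gap≡0 = square-gap i (j ∸ i) p∤a (subst (_≤ h) j≡i+gap j≤h)
                (subst (λ k → a * (i * i) ≈ a * (k * k)) j≡i+gap e)

  squares-distinct : ∀ {a i j} → p ∤ a → i ≤ h → j ≤ h → a * (i * i) ≈ a * (j * j) → i ≡ j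
  squares-distinct {i = i} {j} p∤a i≤h j≤h e with ≤-total i j
  ... | inj₁ i≤j = squares-distinct-≤ p∤a i≤j j≤h e
  ... | inj₂ j≤i = sym (squares-distinct-≤ p∤a j≤i i≤h (≈-sym e))

  two-squares : ∀ {a b} → p ∤ a → p ∤ b → ∀ T → ∃₂ λ x y → a * (x * x) + (b * (y * y) + T) ≈ 0
  two-squares {a} {b} p∤a p∤b T = collision (pigeonhole p<2[h+1] residue)
    where
    Solution : Set
    Solution = ∃₂ λ x y → a * (x * x) + (b * (y * y) + T) ≈ 0

    -- p + 1 values a x² and - (b y² + T), x, y ≤ h, in p residue classes: by squares-distinct
    -- the collision is between the two families
    value : Fin (suc h) ⊎ Fin (suc h) → ℕ
    value (inj₁ x) = a * (toℕ x * toℕ x)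
    value (inj₂ y) = pred p * (b * (toℕ y * toℕ y) + T)

    residue : Fin (suc h + suc h) → Fin p
    residue i = value (splitAt (suc h) i) mod p

    p<2[h+1] : p < suc h + suc h
    p<2[h+1] = subst₂ _<_ (sym p≡2h+1) (sym (cong suc (+-suc h h))) ≤-refl

    toℕ≤h : (x : Fin (suc h)) → toℕ x ≤ h
    toℕ≤h x = s≤s⁻¹ (toℕ<n x)

    collide : ∀ u v → u ≢ v → value u ≈ value v → Solution
    collide (inj₁ x) (inj₁ y) u≢v e =
      ⊥-elim (u≢v (cong inj₁ (toℕ-injective (squares-distinct p∤a (toℕ≤h x) (toℕ≤h y) e))))
    collide (inj₂ x) (inj₂ y) u≢v e =
      ⊥-elim (u≢v (cong inj₂ (toℕ-injective
        (squares-distinct p∤b (toℕ≤h x) (toℕ≤h y) (+-cancelʳ T (*-cancelˡ ∤-pred e))))))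
    collide (inj₁ x) (inj₂ y) _ e = toℕ x , toℕ y , (begin
      a * (toℕ x * toℕ x) + S           ≈⟨ +-cong e ≈-refl ⟩
      pred p * S + S                    ≡⟨ +-comm (pred p * S) S ⟩
      S + pred p * S                    ≈⟨ +-inverseʳ S ⟩
      0                                 ∎)
      where
      open ≈-Reasoning
      S = b * (toℕ y * toℕ y) + T
    collide (inj₂ y) (inj₁ x) u≢v e = collide (inj₁ x) (inj₂ y) (u≢v ∘ sym) (≈-sym e)

    collision : (∃₂ λ i j → i Fin.< j × residue i ≡ residue j) → Solution
    collision (i , j , i<j , residues≡) = collide _ _ split≢ (mod-≡ (begin
      value (splitAt (suc h) i) % p     ≡⟨ toℕ-fromℕ< _ ⟨
      toℕ (residue i)                   ≡⟨ cong toℕ residues≡ ⟩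
      toℕ (residue j)                   ≡⟨ toℕ-fromℕ< _ ⟩
      value (splitAt (suc h) j) % p     ∎))
      where
      open ≡-Reasoning
      split≢ : splitAt (suc h) i ≢ splitAt (suc h) j
      split≢ e = <⇒≢ i<j (cong toℕ (begin
        i                                  ≡⟨ join-splitAt (suc h) (suc h) i ⟨
        join (suc h) (suc h) (splitAt (suc h) i) ≡⟨ cong (join (suc h) (suc h)) e ⟩
        join (suc h) (suc h) (splitAt (suc h) j) ≡⟨ join-splitAt (suc h) (suc h) j ⟩
        j                                  ∎))

data AtLeast {A : Set} (P : A → Set) : ℕ → List A → Set where
  stop : ∀ {xs} → AtLeast P 0 xs
  pick : ∀ {n x xs} (gap : List A) → P x → AtLeast P n xs → AtLeast P (suc n) (gap ++ x ∷ xs)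

module _ {A : Set} {P : A → Set} where

  skip : ∀ {n x xs} → AtLeast P n xs → AtLeast P n (x ∷ xs)
  skip stop = stop
  skip {x = x} (pick gap px rest) = pick (x ∷ gap) px rest

  weaken : ∀ {m n xs} → m ≤ n → AtLeast P n xs → AtLeast P m xs
  weaken z≤n _ = stop
  weaken (s≤s m≤n) (pick gap px rest) = pick gap px (weaken m≤n rest)

diagonalForm : List ℕ → List ℕ → ℕ
diagonalForm (c ∷ cs) (u ∷ us) = c * (u * u) + diagonalForm cs us
diagonalForm _        _        = 0

ones : List ℕ → List ℕ
ones = map (λ _ → 1)

diagonalForm-ones-++ : ∀ gap cs us → diagonalForm (gap ++ cs) (ones gap ++ us) ≡ sum gap + diagonalForm cs us
diagonalForm-ones-++ []        cs us = refl
diagonalForm-ones-++ (c ∷ gap) cs us = begin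
  c * 1 + diagonalForm (gap ++ cs) (ones gap ++ us) ≡⟨ cong₂ _+_ (*-identityʳ c) (diagonalForm-ones-++ gap cs us) ⟩
  c + (sum gap + diagonalForm cs us)                ≡⟨ +-assoc c (sum gap) _ ⟨
  c + sum gap + diagonalForm cs us                  ∎
  where open ≡-Reasoning

diagonalForm-ones : ∀ cs → diagonalForm cs (ones cs) ≡ sum cs
diagonalForm-ones cs = begin
  diagonalForm cs (ones cs)                 ≡⟨ cong₂ diagonalForm (++-identityʳ cs) (++-identityʳ (ones cs)) ⟨
  diagonalForm (cs ++ []) (ones cs ++ [])   ≡⟨ diagonalForm-ones-++ cs [] [] ⟩
  sum cs + 0                                ≡⟨ +-identityʳ (sum cs) ⟩
  sum cs                                    ∎
  where open ≡-Reasoning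

diagonalForm-scale : ∀ s cs us → diagonalForm cs (map (s *_) us) ≡ s * s * diagonalForm cs us
diagonalForm-scale s (c ∷ cs) (u ∷ us) = begin
  c * (s * u * (s * u)) + diagonalForm cs (map (s *_) us) ≡⟨ cong (c * (s * u * (s * u)) +_) (diagonalForm-scale s cs us) ⟩
  c * (s * u * (s * u)) + s * s * diagonalForm cs us     ≡⟨ lemma c s u (diagonalForm cs us) ⟩
  s * s * (c * (u * u) + diagonalForm cs us)             ∎
  where
  open ≡-Reasoning
  lemma : ∀ c s u F → c * (s * u * (s * u)) + s * s * F ≡ s * s * (c * (u * u) + F)
  lemma = solve-∀
diagonalForm-scale s []       _        = sym (*-zeroʳ (s * s))
diagonalForm-scale s (_ ∷ _)  []       = sym (*-zeroʳ (s * s))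

All-ones : ∀ {P : ℕ → Set} → P 1 → ∀ gap → All P (ones gap)
All-ones p1 gap = All.map⁺ (All.universal (λ _ → p1) gap)

length-ones-++ : ∀ gap {cs us} → length us ≡ length cs → length (ones gap ++ us) ≡ length (gap ++ cs)
length-ones-++ gap {cs} {us} eq = begin
  length (ones gap ++ us)    ≡⟨ length-++ (ones gap) ⟩
  length (ones gap) + length us ≡⟨ cong₂ _+_ (length-map _ gap) eq ⟩
  length gap + length cs     ≡⟨ length-++ gap ⟨
  length (gap ++ cs)         ∎
  where open ≡-Reasoning

module PrimeAtLeast7 {p : ℕ} (p-prime : Prime p) (7≤p : 7 ≤ p) where

  private
    p-odd : ∃ λ h → p ≡ suc (h + h)
    p-odd = odd-prime p-prime (≤-trans (s≤s (s≤s (s≤s z≤n))) 7≤p)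

  h : ℕ
  h = proj₁ p-odd

  p≡2h+1 : p ≡ suc (h + h)
  p≡2h+1 = proj₂ p-odd

  open OddPrime p-prime {h} p≡2h+1 public

  private instance
    p≢0 : NonZero p
    p≢0 = prime⇒nonZero p-prime

  ∤-≤3 : ∀ {n} → 0 < n → n ≤ 3 → p ∤ n
  ∤-≤3 0<n n≤3 = 0<∧<p⇒∤ 0<n (<-≤-trans (s≤s n≤3) (≤-trans (s≤s (s≤s (s≤s (s≤s z≤n)))) 7≤p))

  ∤1 : p ∤ 1
  ∤1 = ∤-≤3 z<s (s≤s z≤n)

  ∤2 : p ∤ 2
  ∤2 = ∤-≤3 z<s (s≤s (s≤s z≤n))

  ∤3 : p ∤ 3
  ∤3 = ∤-≤3 z<s (s≤s (s≤s (s≤s z≤n)))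

  3≤h : 3 ≤ h
  3≤h = ≮⇒≥ λ h<3 → <⇒≱ (s≤s (≤-trans (s≤s (+-mono-≤ (s≤s⁻¹ h<3) (s≤s⁻¹ h<3))) (n≤1+n 5)))
                          (subst (7 ≤_) p≡2h+1 7≤p)

  square-≈0 : ∀ a {x} → p ∣ x → a * (x * x) ≈ 0
  square-≈0 a {x} p∣x = ≈-trans (*-cong (≈-refl {a}) (*-cong (∣⇒≈0 p∣x) ≈-refl)) (≡⇒≈ (*-zeroʳ a))

  UnitSolution₂ : ℕ → ℕ → ℕ → Set
  UnitSolution₂ a b T = ∃₂ λ X Y → p ∤ X × p ∤ Y × a * (X * X) + (b * (Y * Y) + T) ≈ 0

  module _ {a b : ℕ} (p∤a : p ∤ a) (p∤b : p ∤ b) where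

    private
      Bad : ℕ → Set
      Bad l = p ∣ a + b * (l * l) ⊎ b * (l * l) ≈ a

      bad? : ∀ l → Dec (Bad l)
      bad? l = (p ∣? a + b * (l * l)) ⊎-dec (b * (l * l) ≈? a)

      kind : ∀ l → Bad l → Fin 2
      kind _ (inj₁ _) = Fin.zero
      kind _ (inj₂ _) = Fin.suc Fin.zero

      -- each kind of badness pins down b l², hence l ≤ h
      same-kind⇒≡ : ∀ {l l′} → l ≤ h → l′ ≤ h → (x : Bad l) (y : Bad l′) →
                    kind l x ≡ kind l′ y → l ≡ l′
      same-kind⇒≡ l≤h l′≤h (inj₁ x) (inj₁ y) _ =
        squares-distinct p∤b l≤h l′≤h (+-cancelˡ a (≈-trans (∣⇒≈0 x) (≈-sym (∣⇒≈0 y))))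
      same-kind⇒≡ l≤h l′≤h (inj₂ x) (inj₂ y) _ = squares-distinct p∤b l≤h l′≤h (≈-trans x (≈-sym y))
      same-kind⇒≡ _ _ (inj₁ _) (inj₂ _) ()
      same-kind⇒≡ _ _ (inj₂ _) (inj₁ _) ()

      not-all-bad : ¬ (∀ (i : Fin 3) → Bad (suc (toℕ i)))
      not-all-bad bad with pigeonhole (s≤s (s≤s (s≤s z≤n))) (λ i → kind _ (bad i))
      ... | i , j , i<j , same =
        <⇒≢ i<j (suc-injective (same-kind⇒≡ (index≤h i) (index≤h j) (bad i) (bad j) same))
        where
        index≤h : (i : Fin 3) → suc (toℕ i) ≤ h
        index≤h i = ≤-trans (toℕ<n i) 3≤h

    slope : ∃ λ l → 0 < l × l ≤ 3 × p ∤ a + b * (l * l) × ¬ b * (l * l) ≈ a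
    slope with ¬∀⟶∃¬ 3 (λ i → Bad (suc (toℕ i))) (λ i → bad? (suc (toℕ i))) not-all-bad
    ... | i , good = suc (toℕ i) , z<s , toℕ<n i , good ∘ inj₁ , good ∘ inj₂

    -- Given a point (x₀, 0), the line of slope l through it meets a X² + b Y² + T ≈ 0 again
    -- at X = x₀ + s, Y = l s with (a + b l²) s ≈ - 2 a x₀; the choice of l keeps X and Y units.
    off-axis : ∀ {x₀ T} → p ∤ x₀ → a * (x₀ * x₀) + T ≈ 0 → UnitSolution₂ a b T
    off-axis {x₀} {T} p∤x₀ on-axis with slope
    ... | l , 0<l , l≤3 , p∤D , bl²≉a with linear-solvable p∤D (2 * (a * x₀))
    ... | s , Z+Ds≈0 = x₀ + s , l * s , p∤X , ∤-* (∤-≤3 0<l l≤3) p∤s , on-curve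
      where
      D = a + b * (l * l)
      Z = 2 * (a * x₀)

      p∤s : p ∤ s
      p∤s p∣s = ∤-* ∤2 (∤-* p∤a p∤x₀) (≈0⇒∣ (begin
        Z              ≡⟨ +-identityʳ Z ⟨
        Z + 0          ≡⟨ cong (Z +_) (*-zeroʳ D) ⟨
        Z + D * 0      ≈⟨ +-cong (≈-refl {Z}) (*-cong (≈-refl {D}) (∣⇒≈0 p∣s)) ⟨
        Z + D * s      ≈⟨ Z+Ds≈0 ⟩
        0              ∎))
        where open ≈-Reasoning

      on-curve : a * ((x₀ + s) * (x₀ + s)) + (b * ((l * s) * (l * s)) + T) ≈ 0
      on-curve = begin
        a * ((x₀ + s) * (x₀ + s)) + (b * ((l * s) * (l * s)) + T) ≡⟨ expand a b l x₀ s T ⟩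
        (a * (x₀ * x₀) + T) + s * (Z + D * s)                    ≈⟨ +-cong on-axis (*-cong (≈-refl {s}) Z+Ds≈0) ⟩
        0 + s * 0                                               ≡⟨ *-zeroʳ s ⟩
        0                                                       ∎
        where
        open ≈-Reasoning
        expand : ∀ a b l x₀ s T → a * ((x₀ + s) * (x₀ + s)) + (b * ((l * s) * (l * s)) + T)
                                ≡ (a * (x₀ * x₀) + T) + s * (2 * (a * x₀) + (a + b * (l * l)) * s)
        expand = solve-∀

      p∤X : p ∤ x₀ + s
      p∤X p∣X = bl²≉a (*-cancelʳ p∤x₀ (+-cancelˡ (a * x₀) (begin
        a * x₀ + b * (l * l) * x₀     ≡⟨ split a (b * (l * l)) x₀ ⟩
        D * x₀                        ≈⟨ +-cancelʳ (D * s) (begin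
          D * x₀ + D * s                ≡⟨ *-distribˡ-+ D x₀ s ⟨
          D * (x₀ + s)                  ≈⟨ *-cong (≈-refl {D}) (∣⇒≈0 p∣X) ⟩
          D * 0                         ≡⟨ *-zeroʳ D ⟩
          0                             ≈⟨ Z+Ds≈0 ⟨
          Z + D * s                     ∎) ⟩
        Z                             ≡⟨ double (a * x₀) ⟩
        a * x₀ + a * x₀               ∎)))
        where
        open ≈-Reasoning
        split : ∀ a c x → a * x + c * x ≡ (a + c) * x
        split = solve-∀
        double : ∀ y → 2 * y ≡ y + y
        double = solve-∀

  two-unit-squares : ∀ {a b T} → p ∤ a → p ∤ b → p ∤ T → UnitSolution₂ a b T
  two-unit-squares {a} {b} {T} p∤a p∤b p∤T = make-units (two-squares p∤a p∤b T)
    where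
    swap-roles : UnitSolution₂ b a T → UnitSolution₂ a b T
    swap-roles (Y , X , p∤Y , p∤X , e) = X , Y , p∤X , p∤Y , ≈-trans (≡⇒≈ (swap a b X Y T)) e
      where
      swap : ∀ a b X Y T → a * (X * X) + (b * (Y * Y) + T) ≡ b * (Y * Y) + (a * (X * X) + T)
      swap = solve-∀

    make-units : (∃₂ λ x y → a * (x * x) + (b * (y * y) + T) ≈ 0) → UnitSolution₂ a b T
    make-units (x , y , e) = by-cases (p ∣? x) (p ∣? y)
      where
      by-cases : Dec (p ∣ x) → Dec (p ∣ y) → UnitSolution₂ a b T
      by-cases (no p∤x) (no p∤y) = x , y , p∤x , p∤y , e
      by-cases (no p∤x) (yes p∣y) = off-axis p∤a p∤b p∤x (begin
        a * (x * x) + T                  ≈⟨ +-cong (≈-refl {a * (x * x)}) (+-cong (square-≈0 b p∣y) (≈-refl {T})) ⟨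
        a * (x * x) + (b * (y * y) + T)  ≈⟨ e ⟩
        0                                ∎)
        where open ≈-Reasoning
      by-cases (yes p∣x) _ = swap-roles (off-axis p∤b p∤a p∤y on-axis)
        where
        on-axis : b * (y * y) + T ≈ 0
        on-axis = ≈-trans (≈-sym (+-cong (square-≈0 a p∣x) ≈-refl)) e
        p∤y : p ∤ y
        p∤y p∣y = p∤T (≈0⇒∣ (≈-trans (≈-sym (+-cong (square-≈0 b p∣y) ≈-refl)) on-axis))

  UnitSolution₃ : (ℕ → Set) → ℕ → ℕ → ℕ → ℕ → Set
  UnitSolution₃ P a b c T = ∃ λ x → ∃₂ λ y z → p ∤ x × p ∤ y × p ∤ z ×
                         P (a * (x * x) + (b * (y * y) + (c * (z * z) + T)))

  three-unit-squares : ∀ {a b c} → p ∤ a → p ∤ b → p ∤ c → ∀ T → UnitSolution₃ (_≈ 0) a b c T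
  three-unit-squares {a} {b} {c} p∤a p∤b p∤c T = by-cases (p ∣? c * (1 * 1) + T)
    where
    with-z : ∀ z → p ∤ z → UnitSolution₂ a b (c * (z * z) + T) → UnitSolution₃ (_≈ 0) a b c T
    with-z z p∤z (x , y , p∤x , p∤y , e) = x , y , z , p∤x , p∤y , p∤z , e

    -- if z = 1 fails then z = 2 works, the two values differing by 3c
    p∤T₂ : p ∣ c * (1 * 1) + T → p ∤ c * (2 * 2) + T
    p∤T₂ p∣T₁ p∣T₂ = ∤-* ∤3 p∤c (≈0⇒∣ (+-cancelˡ (c * (1 * 1) + T) (begin
      c * (1 * 1) + T + 3 * c     ≡⟨ regroup c T ⟩
      c * (2 * 2) + T             ≈⟨ ∣⇒≈0 p∣T₂ ⟩
      0                           ≈⟨ ∣⇒≈0 p∣T₁ ⟨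
      c * (1 * 1) + T             ≡⟨ +-identityʳ _ ⟨
      c * (1 * 1) + T + 0         ∎)))
      where
      open ≈-Reasoning
      regroup : ∀ c T → c * (1 * 1) + T + 3 * c ≡ c * (2 * 2) + T
      regroup = solve-∀

    by-cases : Dec (p ∣ c * (1 * 1) + T) → UnitSolution₃ (_≈ 0) a b c T
    by-cases (no p∤T₁)  = with-z 1 ∤1 (two-unit-squares p∤a p∤b p∤T₁)
    by-cases (yes p∣T₁) = with-z 2 ∤2 (two-unit-squares p∤a p∤b (p∤T₂ p∣T₁))

  hensel : ∀ {a x S} k → p ∤ a → p ∤ x → p ^ suc k ∣ a * (x * x) + S →
           ∃ λ x′ → x′ ≈ x × p ^ suc (suc k) ∣ a * (x′ * x′) + S
  hensel {a} {x} {S} k p∤a p∤x (divides M eqM) =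
    lift (linear-solvable (∤-* ∤2 (∤-* p∤a p∤x)) M)
    where
    Q = p ^ k
    -- x′ = x + p^(k+1) t, where t cancels the first-order term 2 a x t p^(k+1) modulo p^(k+2)
    lift : (∃ λ t → M + 2 * (a * x) * t ≈ 0) →
           ∃ λ x′ → x′ ≈ x × p ^ suc (suc k) ∣ a * (x′ * x′) + S
    lift (t , e) = x + p * Q * t , x′≈x , divides (j + Q * (a * (t * t))) (begin
      a * ((x + p * Q * t) * (x + p * Q * t)) + S
        ≡⟨ expand a x p Q t S ⟩
      (a * (x * x) + S) + p * Q * (2 * (a * x) * t) + p * Q * (p * Q) * (a * (t * t))
        ≡⟨ cong (λ v → v + p * Q * (2 * (a * x) * t) + p * Q * (p * Q) * (a * (t * t))) eqM ⟩
      M * (p * Q) + p * Q * (2 * (a * x) * t) + p * Q * (p * Q) * (a * (t * t))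
        ≡⟨ factor M p Q (2 * (a * x) * t) (a * (t * t)) ⟩
      p * Q * (M + 2 * (a * x) * t) + p * Q * (p * Q) * (a * (t * t))
        ≡⟨ cong (λ v → p * Q * v + p * Q * (p * Q) * (a * (t * t))) eqj ⟩
      p * Q * (j * p) + p * Q * (p * Q) * (a * (t * t))
        ≡⟨ collect j p Q (a * (t * t)) ⟩
      (j + Q * (a * (t * t))) * (p * (p * Q))
        ∎)
      where
      open ≡-Reasoning
      j : ℕ
      j = quotient (≈0⇒∣ e)
      eqj : M + 2 * (a * x) * t ≡ j * p
      eqj = m∣n⇒n≡quotient*m (≈0⇒∣ e)
      x′≈x : x + p * Q * t ≈ x
      x′≈x = ≈-trans (≡⇒≈ (cong (x +_) (rearrange p Q t))) (+*n≈ x (Q * t))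
        where
        rearrange : ∀ p Q t → p * Q * t ≡ Q * t * p
        rearrange = solve-∀
      expand : ∀ a x p Q t S → a * ((x + p * Q * t) * (x + p * Q * t)) + S
             ≡ (a * (x * x) + S) + p * Q * (2 * (a * x) * t) + p * Q * (p * Q) * (a * (t * t))
      expand = solve-∀
      factor : ∀ M p Q Z W → M * (p * Q) + p * Q * Z + p * Q * (p * Q) * W
             ≡ p * Q * (M + Z) + p * Q * (p * Q) * W
      factor = solve-∀
      collect : ∀ j p Q W → p * Q * (j * p) + p * Q * (p * Q) * W ≡ (j + Q * W) * (p * (p * Q))
      collect = solve-∀

  three-unit-squares-mod-p^ : ∀ {a b c} k → p ∤ a → p ∤ b → p ∤ c → ∀ T →
                              UnitSolution₃ (p ^ suc k ∣_) a b c T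
  three-unit-squares-mod-p^ zero p∤a p∤b p∤c T =
    let x , y , z , p∤x , p∤y , p∤z , e = three-unit-squares p∤a p∤b p∤c T
    in  x , y , z , p∤x , p∤y , p∤z , ∣-trans (∣-reflexive (*-identityʳ p)) (≈0⇒∣ e)
  three-unit-squares-mod-p^ {a} {b} {c} (suc k) p∤a p∤b p∤c T =
    lift-x (three-unit-squares-mod-p^ k p∤a p∤b p∤c T)
    where
    lift-x : UnitSolution₃ (p ^ suc k ∣_) a b c T → UnitSolution₃ (p ^ suc (suc k) ∣_) a b c T
    lift-x (x , y , z , p∤x , p∤y , p∤z , d) =
      let x′ , x′≈x , d′ = hensel k p∤a p∤x d
      in  x′ , y , z , ∤-resp-≈ (≈-sym x′≈x) p∤x , p∤y , p∤z , d′

  diagonal-unit-root : ∀ k {cs} → AtLeast (p ∤_) 3 cs →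
                       ∃ λ us → All (p ∤_) us × length us ≡ length cs × p ^ suc k ∣ diagonalForm cs us
  diagonal-unit-root k (pick {x = a} l₁ p∤a (pick {x = b} l₂ p∤b (pick {x = c} l₃ p∤c (stop {l₄})))) =
    let x , y , z , p∤x , p∤y , p∤z , d = three-unit-squares-mod-p^ k p∤a p∤b p∤c T
    in  weights x y z
      , All.++⁺ (All-ones ∤1 l₁) (p∤x ∷ All.++⁺ (All-ones ∤1 l₂)
                                (p∤y ∷ All.++⁺ (All-ones ∤1 l₃) (p∤z ∷ All-ones ∤1 l₄)))
      , length-ones-++ l₁ (cong suc (length-ones-++ l₂ (cong suc (length-ones-++ l₃ (cong suc
          (length-map _ l₄))))))
      , subst (p ^ suc k ∣_) (sym (value x y z)) d
    where
    T = sum l₁ + (sum l₂ + (sum l₃ + sum l₄))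
    weights : ℕ → ℕ → ℕ → List ℕ
    weights x y z = ones l₁ ++ x ∷ ones l₂ ++ y ∷ ones l₃ ++ z ∷ ones l₄
    value : ∀ x y z → diagonalForm (l₁ ++ a ∷ l₂ ++ b ∷ l₃ ++ c ∷ l₄) (weights x y z)
                    ≡ a * (x * x) + (b * (y * y) + (c * (z * z) + T))
    value x y z = begin
      diagonalForm (l₁ ++ a ∷ l₂ ++ b ∷ l₃ ++ c ∷ l₄) (weights x y z)
        ≡⟨ diagonalForm-ones-++ l₁ _ _ ⟩
      sum l₁ + (a * (x * x) + diagonalForm (l₂ ++ b ∷ l₃ ++ c ∷ l₄) (ones l₂ ++ y ∷ ones l₃ ++ z ∷ ones l₄))
        ≡⟨ cong (λ v → sum l₁ + (a * (x * x) + v)) (diagonalForm-ones-++ l₂ _ _) ⟩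
      sum l₁ + (a * (x * x) + (sum l₂ + (b * (y * y) + diagonalForm (l₃ ++ c ∷ l₄) (ones l₃ ++ z ∷ ones l₄))))
        ≡⟨ cong (λ v → sum l₁ + (a * (x * x) + (sum l₂ + (b * (y * y) + v)))) (diagonalForm-ones-++ l₃ _ _) ⟩
      sum l₁ + (a * (x * x) + (sum l₂ + (b * (y * y) + (sum l₃ + (c * (z * z) + diagonalForm l₄ (ones l₄))))))
        ≡⟨ cong (λ v → sum l₁ + (a * (x * x) + (sum l₂ + (b * (y * y) + (sum l₃ + (c * (z * z) + v))))))
                (diagonalForm-ones l₄) ⟩
      sum l₁ + (a * (x * x) + (sum l₂ + (b * (y * y) + (sum l₃ + (c * (z * z) + sum l₄)))))
        ≡⟨ regroup (sum l₁) (sum l₂) (sum l₃) (sum l₄) (a * (x * x)) (b * (y * y)) (c * (z * z)) ⟩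
      a * (x * x) + (b * (y * y) + (c * (z * z) + T))
        ∎
      where
      open ≡-Reasoning
      regroup : ∀ s₁ s₂ s₃ s₄ A B C → s₁ + (A + (s₂ + (B + (s₃ + (C + s₄)))))
                                    ≡ A + (B + (C + (s₁ + (s₂ + (s₃ + s₄)))))
      regroup = solve-∀

module SquareWeights (m : ℕ) .{{_ : NonZero m}} where

  open Congruence m

  square : ℕ → Fin m
  square n = (n * n) mod m

  toℕ-mod : ∀ x → toℕ (x mod m) ≡ x % m
  toℕ-mod x = toℕ-fromℕ< (m%n<n x m)

  square-nonzeroSquare : ∀ n → m ∤ n * n → NonzeroSquare m (square n)
  square-nonzeroSquare n m∤n² = nonzero , n mod m , r / m , (begin
    toℕ (n mod m) * toℕ (n mod m)   ≡⟨ m≡m%n+[m/n]*n r m ⟩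
    r % m + r / m * m               ≡⟨ +-comm (r % m) (r / m * m) ⟩
    r / m * m + r % m               ≡⟨ cong (r / m * m +_) r%m≡n²%m ⟩
    r / m * m + toℕ (square n)      ∎)
    where
    open ≡-Reasoning
    r = toℕ (n mod m) * toℕ (n mod m)
    nonzero : toℕ (square n) ≢ 0
    nonzero e = m∤n² (≈0⇒∣ (≈-trans (≈-sym (%-≈ (n * n))) (≡⇒≈ (trans (sym (toℕ-mod (n * n))) e))))
    r%m≡n²%m : r % m ≡ toℕ (square n)
    r%m≡n²%m = begin
      r % m                     ≡⟨ cong₂ (λ u v → (u * v) % m) (toℕ-mod n) (toℕ-mod n) ⟩
      (n % m * (n % m)) % m     ≡⟨ rem-≡ (*-cong (%-≈ n) (%-≈ n)) ⟩
      (n * n) % m               ≡⟨ toℕ-mod (n * n) ⟨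
      toℕ (square n)            ∎

  weightedSum-squares : ∀ ns xs → weightedSum (map square ns) xs ≈ diagonalForm (map toℕ xs) ns
  weightedSum-squares []       []       = ≈-refl
  weightedSum-squares []       (_ ∷ _)  = ≈-refl
  weightedSum-squares (_ ∷ _)  []       = ≈-refl
  weightedSum-squares (n ∷ ns) (x ∷ xs) = +-cong term (weightedSum-squares ns xs)
    where
    term : toℕ (square n) * toℕ x ≈ toℕ x * (n * n)
    term = begin
      toℕ (square n) * toℕ x    ≡⟨ cong (_* toℕ x) (toℕ-mod (n * n)) ⟩
      (n * n) % m * toℕ x       ≈⟨ *-cong (%-≈ (n * n)) (≈-refl {toℕ x}) ⟩
      n * n * toℕ x             ≡⟨ *-comm (n * n) (toℕ x) ⟩
      toℕ x * (n * n)           ∎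
      where open ≈-Reasoning

  roots⇒weightedZeroSum : ∀ ns xs → length ns ≡ length xs → All (λ n → m ∤ n * n) ns →
                          m ∣ diagonalForm (map toℕ xs) ns → WeightedZeroSum m xs
  roots⇒weightedZeroSum ns xs len nonzero m∣form =
      map square ns
    , All.map⁺ (All.map (λ {n} → square-nonzeroSquare n) nonzero)
    , trans (length-map square ns) len
    , ≈0⇒∣ (≈-trans (weightedSum-squares ns xs) (∣⇒≈0 m∣form))

module EvenPower {p : ℕ} (p-prime : Prime p) (7≤p : 7 ≤ p) (R : ℕ) where

  open PrimeAtLeast7 p-prime 7≤p

  A S m : ℕ
  A = p ^ R
  S = p * A
  m = p ^ (suc (suc R) * 2)

  private instance
    p≢0 : NonZero p
    p≢0 = prime⇒nonZero p-prime
    A≢0 : NonZero A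
    A≢0 = m^n≢0 p R
    S≢0 : NonZero S
    S≢0 = m*n≢0 p A
    A²≢0 : NonZero (A * A)
    A²≢0 = m*n≢0 A A
    S²≢0 : NonZero (S * S)
    S²≢0 = m*n≢0 S S
    m≢0 : NonZero m
    m≢0 = m^n≢0 p (suc (suc R) * 2)

  open SquareWeights m using (roots⇒weightedZeroSum)

  m≡S²p² : m ≡ S * S * (p * p)
  m≡S²p² = trans (sym (^-*-assoc p (suc (suc R)) 2)) (lemma p A)
    where
    lemma : ∀ p A → p * (p * A) * (p * (p * A) * 1) ≡ p * A * (p * A) * (p * p)
    lemma = solve-∀

  m≡A²p⁴ : m ≡ A * A * (p * (p * (p * p)))
  m≡A²p⁴ = trans m≡S²p² (lemma p A)
    where
    lemma : ∀ p A → p * A * (p * A) * (p * p) ≡ A * A * (p * (p * (p * p)))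
    lemma = solve-∀

  p²≡p*p : p ^ 2 ≡ p * p
  p²≡p*p = cong (p *_) (^-identityʳ p)

  p³≡p*[p*p] : p ^ 3 ≡ p * (p * p)
  p³≡p*[p*p] = cong (p *_) p²≡p*p

  m∤S²u² : ∀ {u} → p ∤ u → m ∤ S * u * (S * u)
  m∤S²u² {u} p∤u = subst₂ _∤_ (sym m≡S²p²) (lemma S u) (∤-square-multiple (S * S) (∣n⇒∣m*n p ∣-refl) p∤u)
    where
    lemma : ∀ S u → S * S * (u * u) ≡ S * u * (S * u)
    lemma = solve-∀

  m∤A²u² : ∀ {u} → p ∤ u → m ∤ A * u * (A * u)
  m∤A²u² {u} p∤u = subst₂ _∤_ (sym m≡A²p⁴) (lemma A u) (∤-square-multiple (A * A) (m∣m*n (p * (p * p))) p∤u)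
    where
    lemma : ∀ A u → A * A * (u * u) ≡ A * u * (A * u)
    lemma = solve-∀

  single : ∀ x → p * p ∣ toℕ x → WeightedZeroSum m (x ∷ [])
  single x p²∣x = roots⇒weightedZeroSum (S * 1 ∷ []) (x ∷ []) refl (m∤S²u² ∤1 ∷ [])
    (subst₂ _∣_ (sym m≡S²p²) (lemma S (toℕ x)) (*-monoʳ-∣ (S * S) p²∣x))
    where
    lemma : ∀ S v → S * S * v ≡ v * (S * 1 * (S * 1)) + 0
    lemma = solve-∀

  unit-majority : ∀ xs → AtLeast (p ∤_) 3 (map toℕ xs) → WeightedZeroSum m xs
  unit-majority xs units =
    let us , p∤us , len , p²∣form = diagonal-unit-root 1 units
    in  roots⇒weightedZeroSum (map (S *_) us) xs
          (trans (length-map _ us) (trans len (length-map toℕ xs)))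
          (All.map⁺ (All.map m∤S²u² p∤us))
          (subst₂ _∣_ (sym m≡S²p²) (sym (diagonalForm-scale S (map toℕ xs) us))
            (*-monoʳ-∣ (S * S) (∣-trans (∣-reflexive (sym p²≡p*p)) p²∣form)))

  shifted : ∀ {v} → Valuation≤1 v → ℕ
  shifted {v} (val₀ _)     = p * v
  shifted (val₁ {w} _ _) = w

  shiftedList : ∀ {vs} → All Valuation≤1 vs → List ℕ
  shiftedList []         = []
  shiftedList (c ∷ cl) = shifted c ∷ shiftedList cl

  count : ∀ {vs} (cl : All Valuation≤1 vs) →
          ∃₂ λ a b → a + b ≡ length vs × AtLeast (p ∤_) a vs × AtLeast (p ∤_) b (shiftedList cl)
  count [] = 0 , 0 , refl , stop , stop
  count (val₀ p∤v ∷ cl) =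
    let a , b , a+b≡ , as , bs = count cl
    in  suc a , b , cong suc a+b≡ , pick [] p∤v as , skip bs
  count (val₁ _ p∤w ∷ cl) =
    let a , b , a+b≡ , as , bs = count cl
    in  a , suc b , trans (+-suc a b) (cong suc a+b≡) , skip as , pick [] p∤w bs

  -- the roots A·p·u at valuation 0 and A·u at valuation 1 make every term a multiple of A² p
  shifted-roots : ∀ {vs} (cl : All Valuation≤1 vs) us → All (p ∤_) us → length us ≡ length (shiftedList cl) →
                  ∃ λ ns → length ns ≡ length vs × All (λ n → m ∤ n * n) ns ×
                    diagonalForm vs ns ≡ A * A * (p * diagonalForm (shiftedList cl) us)
  shifted-roots [] [] [] _ = [] , refl , [] , sym (trans (cong (A * A *_) (*-zeroʳ p)) (*-zeroʳ (A * A)))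
  shifted-roots (_∷_ {v} (val₀ _) cl) (u ∷ us) (p∤u ∷ p∤us) len =
    let ns , len′ , nonzero , form≡ = shifted-roots cl us p∤us (suc-injective len)
    in  S * u ∷ ns , cong suc len′ , m∤S²u² p∤u ∷ nonzero ,
        trans (cong (v * (S * u * (S * u)) +_) form≡) (lemma v p A u (diagonalForm (shiftedList cl) us))
    where
    lemma : ∀ v p A u F → v * (p * A * u * (p * A * u)) + A * A * (p * F) ≡ A * A * (p * (p * v * (u * u) + F))
    lemma = solve-∀
  shifted-roots (_∷_ {v} (val₁ {w} v≡pw _) cl) (u ∷ us) (p∤u ∷ p∤us) len =
    let ns , len′ , nonzero , form≡ = shifted-roots cl us p∤us (suc-injective len)
    in  A * u ∷ ns , cong suc len′ , m∤A²u² p∤u ∷ nonzero ,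
        trans (cong₂ (λ v′ F → v′ * (A * u * (A * u)) + F) v≡pw form≡)
              (lemma p w A u (diagonalForm (shiftedList cl) us))
    where
    lemma : ∀ p w A u F → p * w * (A * u * (A * u)) + A * A * (p * F) ≡ A * A * (p * (w * (u * u) + F))
    lemma = solve-∀

  p-majority : ∀ xs (cl : All Valuation≤1 (map toℕ xs)) → AtLeast (p ∤_) 3 (shiftedList cl) → WeightedZeroSum m xs
  p-majority xs cl units =
    let us , p∤us , len , p³∣form = diagonal-unit-root 2 units
        ns , len′ , nonzero , form≡ = shifted-roots cl us p∤us len
    in  roots⇒weightedZeroSum ns xs (trans len′ (length-map toℕ xs)) nonzero
          (subst₂ _∣_ (sym m≡A²p⁴) (sym form≡)
            (*-monoʳ-∣ (A * A) (*-monoʳ-∣ p (∣-trans (∣-reflexive (sym p³≡p*[p*p])) p³∣form))))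

  p²-free : ∀ xs → length xs ≡ 5 → All (λ x → p * p ∤ toℕ x) xs → WeightedZeroSum m xs
  p²-free xs len p²∤xs =
    let a , b , a+b≡5 , as , bs = count cl
    in  [ (λ 3≤a → unit-majority xs (weaken 3≤a as)) , (λ 3≤b → p-majority xs cl (weaken 3≤b bs)) ]′
          (three-of-five a b (trans a+b≡5 (trans (length-map toℕ xs) len)))
    where
    cl : All Valuation≤1 (map toℕ xs)
    cl = All.map⁺ (All.map (λ {x} → valuation≤1 (toℕ x)) p²∤xs)
    three-of-five : ∀ a b → a + b ≡ 5 → 3 ≤ a ⊎ 3 ≤ b
    three-of-five 0 _ refl = inj₂ (s≤s (s≤s (s≤s z≤n)))
    three-of-five 1 _ refl = inj₂ (s≤s (s≤s (s≤s z≤n)))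
    three-of-five 2 _ refl = inj₂ (s≤s (s≤s (s≤s z≤n)))
    three-of-five (suc (suc (suc _))) _ _ = inj₁ (s≤s (s≤s (s≤s z≤n)))

  c-property : CProperty m 5
  c-property xs len with any? (λ x → p * p ∣? toℕ x) xs
  ... | yes p²∣some =
    let x , x∈xs , p²∣x = find p²∣some
        pre , suf , xs≡ = ∈-∃++ x∈xs
    in  pre , x ∷ [] , suf , xs≡ , (λ ()) , single x p²∣x
  ... | no p²∤all = [] , xs , [] , sym (++-identityʳ xs) , (λ { refl → contradiction len λ () }) ,
                    p²-free xs len (¬Any⇒All¬ xs p²∤all)

theorem12 : (p r : ℕ) → Prime p → 7 ≤ p → 4 ≤ r → 2 ∣ r →
    ∃[ k ] (1 ≤ k × k ≤ 5 × CProperty (p ^ r) k)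
theorem12 p r p-prime 7≤p 4≤r (divides (suc (suc R)) r≡[R+2]*2) =
  5 , s≤s z≤n , ≤-refl , subst (λ r → CProperty (p ^ r) 5) (sym r≡[R+2]*2) (EvenPower.c-property p-prime 7≤p R)
theorem12 _ _ _ _ () (divides 0 refl)
theorem12 _ _ _ _ (s≤s (s≤s ())) (divides 1 refl)
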